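{- Let $a, b, d, n$ be positive integers such that $d \mid b$ and $\gcd(a,b)=1$. Let $$S := \left\langle a^n,\ a^n + a^{n-1}d,\ a^n + 2a^{n-1}d,\ \ldots,\ a^n + a^{n-1}b \right\rangle,$$ i.e. the semigroup generated by $a^n + j a^{n-1} d$ for $0 \le j \le b/d$. If $b \le a$, let $S_1 := \left\langle S \cup \{a^n + a^{n-2}b^2,\ a^n + a^{n-3}b^3, \ldots,\ a^n + ab^{n-1},\ a^n + b^n\}\right\rangle$. Without any condition relating $a$ and $b$, let $S_2 := \left\langle S \cup \{a^n + a^{n-1}b + a^{n-2}b^2,\ \ldots,\ a^n + a^{n-1}b + a^{n-2}b^2 + \cdots + b^n\}\right\rangle$ (the added generators being $a^n + \sum_{i=1}^{j} a^{n-i}b^i$ for $2 \le j \le n$). Then (when $b \le a$ in the first case) $$F(S_1) = a^{n-1}\left(a\left\lceil \tfrac{(a-1)d}{b} \right\rceil + ad - a - d\right) + (a-1)\frac{(n-1)a^n(a-b) + b^2\left(a^{n-1}-b^{n-1}\right)}{a-b},$$ $$F(S_2) = a^{n-1}\left(a\left\lceil \tfrac{(a-1)d}{b} \right\rceil + ad - a - d\right) + (a-1)\frac{(n-1)a^{n+1}(a-b) - b^3\left(a^{n-1}-b^{n-1}\right)}{(a-b)^2}.$$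
   Context: $\mathbb{N}$ denotes the nonnegative integers. For a set $A$ of positive integers, $\langle A\rangle$ is the additive submonoid of $\mathbb{N}$ generated by $A$ (all finite sums of elements of $A$, including $0$). A numerical semigroup is a submonoid $S\subseteq\mathbb{N}$ with $\mathbb{N}\setminus S$ finite; its Frobenius number $F(S)$ is the largest integer not in $S$ (with $F(\mathbb{N})=-1$). -}

module Defs where

open import Data.Nat using (ℕ; zero; suc; _+_; _*_; _∸_; _^_; _≤_; _/_)
open import Data.Integer as ℤ using (ℤ; +_)
open import Data.Product using (Σ; _×_)
open import Data.Sum using (_⊎_)
open import Relation.Binary.PropositionalEquality using (_≡_)
open import Relation.Nullary using (¬_)

data ⟨_⟩ (A : ℕ → Set) : ℕ → Set where
  gen-zero : ⟨ A ⟩ 0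
  gen-add  : ∀ {g x} → A g → ⟨ A ⟩ x → ⟨ A ⟩ (g + x)

_∈ℤ_ : ℤ → (ℕ → Set) → Set
z ∈ℤ S = Σ ℕ λ k → (z ≡ + k) × S k

-- f is the Frobenius number of S: the largest integer not in S
-- (so f = -1 exactly when S = ℕ).
IsFrobenius : (ℕ → Set) → ℤ → Set
IsFrobenius S f = ¬ (f ∈ℤ S) × (∀ (z : ℤ) → f ℤ.< z → z ∈ℤ S)

-- Ceiling of m / b for b > 0 (value at b = 0 is irrelevant).
⌈_/_⌉ : ℕ → ℕ → ℕ
⌈ m / zero ⌉ = 0
⌈ m / suc k ⌉ = (m + k) / suc k

-- Generators of S: a^n + j a^(n-1) d for 0 ≤ j ≤ b/d  (j*d ≤ b, using d ∣ b).
GenS : ℕ → ℕ → ℕ → ℕ → ℕ → Set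
GenS a b d n x = Σ ℕ λ j → (j * d ≤ b) × (x ≡ a ^ n + j * a ^ (n ∸ 1) * d)

GenS₁ : ℕ → ℕ → ℕ → ℕ → ℕ → Set
GenS₁ a b d n x = GenS a b d n x
  ⊎ (Σ ℕ λ k → (2 ≤ k) × (k ≤ n) × (x ≡ a ^ n + a ^ (n ∸ k) * b ^ k))

partialSum : ℕ → ℕ → ℕ → ℕ → ℕ
partialSum a b n zero = 0
partialSum a b n (suc j) = partialSum a b n j + a ^ (n ∸ suc j) * b ^ suc j

GenS₂ : ℕ → ℕ → ℕ → ℕ → ℕ → Set
GenS₂ a b d n x = GenS a b d n x
  ⊎ (Σ ℕ λ j → (2 ≤ j) × (j ≤ n) × (x ≡ a ^ n + partialSum a b n j))

firstTerm : ℕ → ℕ → ℕ → ℕ → ℤ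
firstTerm a b d n =
  + (a ^ (n ∸ 1)) ℤ.* (+ (a * ⌈ (a ∸ 1) * d / b ⌉) ℤ.+ + (a * d) ℤ.- + a ℤ.- + d)

-- For n ≥ 2 the generators of S₁ (resp. S₂) at level n are a times those at level n − 1
-- together with one new generator c = aⁿ + bⁿ (resp. aⁿ + Σᵢ₌₁ⁿ aⁿ⁻ⁱ bⁱ), which is coprime to a
-- and already lies in the semigroup of level n − 1. For such a gluing
-- F(⟨a·A ∪ {c}⟩) = a F(⟨A⟩) + (a − 1) c: every element of ⟨a·A ∪ {c}⟩ is a t + c m with t ∈ ⟨A⟩,
-- and reducing m modulo a makes this representation unique. At level 1 both semigroups are
-- generated by the arithmetic sequence a, a + d, …, a + b, whose Frobenius number is
-- a⌈(a − 1)d/b⌉ + ad − a − d. Unrolling the recurrence Fₙ = a Fₙ₋₁ + (a − 1) cₙ, with a geometric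
-- sum for S₂, gives the closed forms.

module Submission where

open import Defs
open import Data.Nat as ℕ
  using (ℕ; zero; suc; _+_; _*_; _^_; _∸_; _≤_; _<_; z≤n; s≤s; z<s; _/_; _%_; _≤?_; >-nonZero)
open import Data.Nat.Properties
open import Data.Nat.Divisibility using (_∣_; divides; ∣m+n∣m⇒∣n; m∣m*n; ∣⇒≤; ∣-trans; ∣1⇒≡1)
open import Data.Nat.Coprimality using (Coprime; coprime-divisor; coprime-Bézout; gcd≡1⇒coprime)
open import Data.Nat.GCD using (gcd; module Bézout)
open import Data.Nat.DivMod using (m≡m%n+[m/n]*n; m%n<n; m%n≤m)
open import Data.Nat.Tactic.RingSolver using (solve-∀)
open import Data.Integer as ℤ using (ℤ; +_; -[1+_])
open import Data.Integer.Properties using (pos-+; pos-*)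
open import Data.Integer.Tactic.RingSolver renaming (solve-∀ to ℤ-solve-∀)
open import Data.Product using (Σ; ∃; ∃₂; ∃-syntax; _×_; _,_; proj₁; proj₂; map; map₂)
open import Data.Sum using (inj₁; inj₂; [_,_])
open import Function using (_∘_; id)
open import Level using (0ℓ)
open import Relation.Binary.PropositionalEquality
  using (_≡_; refl; sym; trans; cong; cong₂; subst; subst₂; module ≡-Reasoning)
open import Relation.Nullary using (yes; no; contradiction)
open import Relation.Unary using (Pred; _⊆_; _≐_; _∪_; ｛_｝; _∉_)
open import Relation.Unary.Properties using (≐-sym)

private variable
  A B S T : Pred ℕ 0ℓ
  a b c d e g k m m′ t t′ x y : ℕ
  F : ℤ

-- The submonoid generated by a set

⟨⟩-+ : ⟨ A ⟩ x → ⟨ A ⟩ y → ⟨ A ⟩ (x + y)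
⟨⟩-+ gen-zero q = q
⟨⟩-+ {y = y} (gen-add {g} {x} Ag p) q = subst ⟨ _ ⟩ (sym (+-assoc g x y)) (gen-add Ag (⟨⟩-+ p q))

⟨⟩-gen : A ⊆ ⟨ A ⟩
⟨⟩-gen {x = g} Ag = subst ⟨ _ ⟩ (+-identityʳ g) (gen-add Ag gen-zero)

⟨⟩-* : ∀ r → ⟨ A ⟩ x → ⟨ A ⟩ (r * x)
⟨⟩-* zero    p = gen-zero
⟨⟩-* (suc r) p = ⟨⟩-+ p (⟨⟩-* r p)

⟨⟩-mono : A ⊆ B → ⟨ A ⟩ ⊆ ⟨ B ⟩
⟨⟩-mono A⊆B gen-zero       = gen-zero
⟨⟩-mono A⊆B (gen-add Ag p) = gen-add (A⊆B Ag) (⟨⟩-mono A⊆B p)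

⟨⟩-resp-≐ : A ≐ B → ⟨ A ⟩ ≐ ⟨ B ⟩
⟨⟩-resp-≐ (A⊆B , B⊆A) = ⟨⟩-mono A⊆B , ⟨⟩-mono B⊆A

-- Conductor and Frobenius number

IsConductor : Pred ℕ 0ℓ → ℕ → Set
IsConductor S g = (∀ {x} → g ≤ x → S x) × (∀ {h} → suc h ≡ g → h ∉ S)

IsConductor⇒IsFrobenius : IsConductor S g → IsFrobenius S (+ g ℤ.- + 1)
IsConductor⇒IsFrobenius {S} {zero} (above , _) = (λ { (_ , () , _) }) , member
  where
  member : ∀ z → -[1+ 0 ] ℤ.< z → z ∈ℤ S
  member (+ x)    _            = x , refl , above z≤n
  member -[1+ _ ] (ℤ.-<- ())
IsConductor⇒IsFrobenius {S} {suc h} (above , below) = (λ { (_ , refl , Sh) → below refl Sh }) , member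
  where
  member : ∀ z → + h ℤ.< z → z ∈ℤ S
  member (+ x)    (ℤ.+<+ h<x) = x , refl , above h<x
  member -[1+ _ ] ()

+∈ℤ⇒∈ : (+ x) ∈ℤ S → S x
+∈ℤ⇒∈ (_ , refl , Sx) = Sx

IsFrobenius⇒IsConductor : IsFrobenius S F → ∃[ g ] F ≡ + g ℤ.- + 1 × IsConductor S g
IsFrobenius⇒IsConductor {F = + h} (h∉S , above) =
  suc h , refl , (λ h<x → +∈ℤ⇒∈ (above _ (ℤ.+<+ h<x))) , λ { refl Sh → h∉S (h , refl , Sh) }
IsFrobenius⇒IsConductor {F = -[1+ 0 ]} (_ , above) =
  0 , refl , (λ {x} _ → +∈ℤ⇒∈ (above (+ x) ℤ.-<+)) , λ ()
IsFrobenius⇒IsConductor {F = -[1+ suc _ ]} (_ , above) with above -[1+ 0 ] (ℤ.-<- z<s)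
... | _ , () , _

IsFrobenius-resp-≐ : S ≐ T → IsFrobenius S F → IsFrobenius T F
IsFrobenius-resp-≐ (S⊆T , T⊆S) (F∉S , above) =
  (λ { (k , eq , Tk) → F∉S (k , eq , T⊆S Tk) }) ,
  λ z F<z → map₂ (map₂ S⊆T) (above z F<z)

-- Two coprime generators

coprime-∣ʳ : Coprime a c → d ∣ c → Coprime a d
coprime-∣ʳ coprime d∣c (i∣a , i∣d) = coprime (i∣a , ∣-trans i∣d d∣c)

coprime-* : Coprime a x → Coprime a y → Coprime a (x * y)
coprime-* coprimeˣ coprimeʸ (i∣a , i∣xy) =
  coprimeʸ (i∣a , coprime-divisor (λ (j∣i , j∣x) → coprimeˣ (∣-trans j∣i i∣a , j∣x)) i∣xy)

coprime-^ : Coprime a b → ∀ n → Coprime a (b ^ n)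
coprime-^ coprime zero    (_ , i∣1) = ∣1⇒≡1 i∣1
coprime-^ coprime (suc n) = coprime-* coprime (coprime-^ coprime n)

coprime-*+ : Coprime a x → ∀ q → Coprime a (a * q + x)
coprime-*+ coprime q (i∣a , i∣aq+x) = coprime (i∣a , ∣m+n∣m⇒∣n i∣aq+x (∣-trans i∣a (m∣m*n q)))

coprime-divisor-<⇒≡0 : Coprime a c → a ∣ c * e → e < a → e ≡ 0
coprime-divisor-<⇒≡0 {e = zero}  _      _    _   = refl
coprime-divisor-<⇒≡0 {e = suc _} coprime a∣ce e<a =
  contradiction (∣⇒≤ (coprime-divisor coprime a∣ce)) (<⇒≱ e<a)

representation-unique-≤ : Coprime a c → m ≤ m′ → m′ < a →
  a * t + c * m ≡ a * t′ + c * m′ → t ≡ t′ × m ≡ m′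
representation-unique-≤ {a} {c} {m} {t = t} {t′} coprime m≤m′ m′<a eq
  with m≤n⇒∃[o]m+o≡n m≤m′
... | k , refl with coprime-divisor-<⇒≡0 coprime a∣ck (≤-<-trans (m≤n+m k m) m′<a)
  where
  shift : ∀ a c t′ m k → a * t′ + c * (m + k) ≡ (a * t′ + c * k) + c * m
  shift = solve-∀
  at≡at′+ck : a * t ≡ a * t′ + c * k
  at≡at′+ck = +-cancelʳ-≡ (c * m) _ _ (trans eq (shift a c t′ m k))
  a∣ck : a ∣ c * k
  a∣ck = ∣m+n∣m⇒∣n (subst (a ∣_) at≡at′+ck (m∣m*n t)) (m∣m*n t′)
... | refl = *-cancelˡ-≡ t t′ a {{>-nonZero (≤-<-trans z≤n m′<a)}} at≡at′ , sym (+-identityʳ m)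
  where
  at≡at′ : a * t ≡ a * t′
  at≡at′ = +-cancelʳ-≡ (c * m) _ _ (trans eq (cong (λ n → a * t′ + c * n) (+-identityʳ m)))

representation-unique : Coprime a c → m < a → m′ < a →
  a * t + c * m ≡ a * t′ + c * m′ → t ≡ t′ × m ≡ m′
representation-unique {m = m} {m′} coprime m<a m′<a eq with ≤-total m m′
... | inj₁ m≤m′ = representation-unique-≤ coprime m≤m′ m′<a eq
... | inj₂ m′≤m = map sym sym (representation-unique-≤ coprime m′≤m m<a (sym eq))

c*m+a*q≡c*[m%a]+a*[q+c*[m/a]] : ∀ a .{{_ : ℕ.NonZero a}} c m q →
  c * m + a * q ≡ c * (m % a) + a * (q + c * (m / a))
c*m+a*q≡c*[m%a]+a*[q+c*[m/a]] a c m q = begin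
  c * m + a * q                       ≡⟨ cong (λ n → c * n + a * q) (m≡m%n+[m/n]*n m a) ⟩
  c * (m % a + m / a * a) + a * q     ≡⟨ regroup c (m % a) (m / a) a q ⟩
  c * (m % a) + a * (q + c * (m / a)) ∎
  where
  open ≡-Reasoning
  regroup : ∀ c r k a q → c * (r + k * a) + a * q ≡ c * r + a * (q + c * k)
  regroup = solve-∀

coprime⇒residue : 0 < a → Coprime a c → ∀ x →
  ∃[ m ] m < a × ∃₂ λ p q → x + a * p ≡ c * m + a * q
coprime⇒residue {a@(suc a′)} {c} _ coprime x = reduce (bézout (coprime-Bézout coprime))
  where
  open ≡-Reasoning
  bézout : Bézout.Identity 1 a c → ∃₂ λ p m → ∃ λ q → x + a * p ≡ c * m + a * q
  -- Here c (x v) ≡ −x (mod a), and −1 ≡ a − 1.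
  bézout (Bézout.+- u v 1+vc≡ua) = c * (x * v) , x * v * a′ , x * u , (begin
    x + a * (c * (x * v))           ≡⟨ expand x a′ c v ⟩
    x * (1 + v * c) + c * (x * v * a′) ≡⟨ cong (λ n → x * n + c * (x * v * a′)) 1+vc≡ua ⟩
    x * (u * a) + c * (x * v * a′)  ≡⟨ regroup x u a c (x * v * a′) ⟩
    c * (x * v * a′) + a * (x * u)  ∎)
    where
    expand : ∀ x a′ c v → x + suc a′ * (c * (x * v)) ≡ x * (1 + v * c) + c * (x * v * a′)
    expand = solve-∀
    regroup : ∀ x u a c y → x * (u * a) + c * y ≡ c * y + a * (x * u)
    regroup = solve-∀
  bézout (Bézout.-+ u v 1+ua≡vc) = x * u , x * v , 0 , (begin
    x + a * (x * u)    ≡⟨ expand x a u ⟩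
    x * (1 + u * a)    ≡⟨ cong (x *_) 1+ua≡vc ⟩
    x * (v * c)        ≡⟨ regroup x v c a ⟩
    c * (x * v) + a * 0 ∎)
    where
    expand : ∀ x a u → x + a * (x * u) ≡ x * (1 + u * a)
    expand = solve-∀
    regroup : ∀ x v c a → x * (v * c) ≡ c * (x * v) + a * 0
    regroup = solve-∀
  reduce : (∃₂ λ p m → ∃ λ q → x + a * p ≡ c * m + a * q) →
           ∃[ m ] m < a × ∃₂ λ p q → x + a * p ≡ c * m + a * q
  reduce (p , m , q , eq) =
    m % a , m%n<n m a , p , q + c * (m / a) , trans eq (c*m+a*q≡c*[m%a]+a*[q+c*[m/a]] a c m q)

c*m<[a∸1]*[c∸1]+a : 0 < c → m < a → c * m < (a ∸ 1) * (c ∸ 1) + a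
c*m<[a∸1]*[c∸1]+a {suc c′} {m} {suc a′} _ m<a = begin-strict
  suc c′ * m       ≤⟨ *-monoʳ-≤ (suc c′) (≤-pred m<a) ⟩
  suc c′ * a′      ≡⟨ regroup a′ c′ ⟩
  a′ * c′ + a′     <⟨ +-monoʳ-< (a′ * c′) (n<1+n a′) ⟩
  a′ * c′ + suc a′ ∎
  where
  open ≤-Reasoning
  regroup : ∀ a′ c′ → suc c′ * a′ ≡ a′ * c′ + a′
  regroup = solve-∀

representable-above : 0 < a → 0 < c → Coprime a c → a * g + (a ∸ 1) * (c ∸ 1) ≤ x →
  ∃₂ λ t m → g ≤ t × m < a × x ≡ a * t + c * m
representable-above {a} {c} {g} {x} 0<a 0<c coprime bound
  with coprime⇒residue 0<a coprime x
... | m , m<a , p , q , eq with p ≤? q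
...   | yes p≤q with m≤n⇒∃[o]m+o≡n p≤q
...     | t , refl = t , m , g≤t , m<a , x≡at+cm
  where
  open ≤-Reasoning
  shift : ∀ x a c m p t → c * m + a * (p + t) ≡ (a * t + c * m) + a * p
  shift = solve-∀
  x≡at+cm : x ≡ a * t + c * m
  x≡at+cm = +-cancelʳ-≡ (a * p) _ _ (trans eq (shift x a c m p t))
  regroup : ∀ a t r → a * t + (r + a) ≡ a * suc t + r
  regroup = solve-∀
  ag<a[1+t] : a * g + (a ∸ 1) * (c ∸ 1) < a * suc t + (a ∸ 1) * (c ∸ 1)
  ag<a[1+t] = begin-strict
    a * g + (a ∸ 1) * (c ∸ 1)     ≤⟨ bound ⟩
    x                             ≡⟨ x≡at+cm ⟩
    a * t + c * m                 <⟨ +-monoʳ-< (a * t) (c*m<[a∸1]*[c∸1]+a 0<c m<a) ⟩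
    a * t + ((a ∸ 1) * (c ∸ 1) + a) ≡⟨ regroup a t ((a ∸ 1) * (c ∸ 1)) ⟩
    a * suc t + (a ∸ 1) * (c ∸ 1) ∎
  g≤t : g ≤ t
  g≤t = ≤-pred (*-cancelˡ-< a g (suc t) (+-cancelʳ-< _ _ _ ag<a[1+t]))
representable-above {a} {c} {g} {x} 0<a 0<c coprime bound | m , m<a , p , q , eq | no p≰q
  with m≤n⇒∃[o]m+o≡n (≰⇒> p≰q)
... | k , refl = contradiction x+a[1+k]≡cm (<⇒≢ cm<x+a[1+k] ∘ sym)
  where
  open ≤-Reasoning
  shift : ∀ x a q k → x + a * (suc q + k) ≡ (x + a * suc k) + a * q
  shift = solve-∀
  x+a[1+k]≡cm : x + a * suc k ≡ c * m
  x+a[1+k]≡cm = +-cancelʳ-≡ (a * q) _ _ (trans (sym (shift x a q k)) eq)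
  cm<x+a[1+k] : c * m < x + a * suc k
  cm<x+a[1+k] = begin-strict
    c * m                      <⟨ c*m<[a∸1]*[c∸1]+a 0<c m<a ⟩
    (a ∸ 1) * (c ∸ 1) + a      ≤⟨ +-mono-≤ (≤-trans (m≤n+m _ (a * g)) bound) (m≤m*n a (suc k)) ⟩
    x + a * suc k              ∎

-- x + a = a g + c (a − 1), and both sides are representations with coefficient of c below a.
conductor-predecessor : .{{_ : ℕ.NonZero a}} → 0 < c → Coprime a c →
  suc x ≡ a * g + (a ∸ 1) * (c ∸ 1) → x ≡ a * t + c * m →
  suc (t + c * (m / a)) ≡ g × m % a ≡ a ∸ 1
conductor-predecessor {a = a@(suc a′)} {c@(suc c′)} {x} {g} {t} {m} _ coprime 1+x≡ x≡at+cm =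
  representation-unique coprime (m%n<n m a) (n<1+n a′) (begin
    a * suc u + c * (m % a)    ≡⟨ shift a c u (m % a) ⟩
    (c * (m % a) + a * u) + a  ≡⟨ cong (_+ a) (sym (c*m+a*q≡c*[m%a]+a*[q+c*[m/a]] a c m t)) ⟩
    (c * m + a * t) + a        ≡⟨ cong (_+ a) (+-comm (c * m) (a * t)) ⟩
    (a * t + c * m) + a        ≡⟨ +-suc (a * t + c * m) a′ ⟩
    suc (a * t + c * m) + a′   ≡⟨ cong (λ n → suc n + a′) (sym x≡at+cm) ⟩
    suc x + a′                 ≡⟨ cong (_+ a′) 1+x≡ ⟩
    (a * g + a′ * c′) + a′     ≡⟨ close a′ c′ g ⟩
    a * g + c * a′             ∎)
  where
  open ≡-Reasoning
  u : ℕ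
  u = t + c * (m / a)
  shift : ∀ a c u r → a * suc u + c * r ≡ (c * r + a * u) + a
  shift = solve-∀
  close : ∀ a′ c′ g → (suc a′ * g + a′ * c′) + a′ ≡ suc a′ * g + suc c′ * a′
  close = solve-∀

-- Gluing

infixr 7 _·_
_·_ : ℕ → Pred ℕ 0ℓ → Pred ℕ 0ℓ
(a · A) x = ∃[ y ] A y × x ≡ a * y

∪-step : {A′ B′ : Pred ℕ 0ℓ} → A′ ≐ a · A → B′ ≐ a · B ∪ ｛ c ｝ → A′ ∪ B′ ≐ a · (A ∪ B) ∪ ｛ c ｝
∪-step {a} {A} {B} {c} {A′} {B′} (A′⊆ , ⊆A′) (B′⊆ , ⊆B′) = to , from
  where
  to : A′ ∪ B′ ⊆ a · (A ∪ B) ∪ ｛ c ｝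
  to (inj₁ x∈A′) with A′⊆ x∈A′
  ... | y , Ay , x≡ay = inj₁ (y , inj₁ Ay , x≡ay)
  to (inj₂ x∈B′) with B′⊆ x∈B′
  ... | inj₁ (y , By , x≡ay) = inj₁ (y , inj₂ By , x≡ay)
  ... | inj₂ c≡x             = inj₂ c≡x
  from : a · (A ∪ B) ∪ ｛ c ｝ ⊆ A′ ∪ B′
  from (inj₁ (y , inj₁ Ay , x≡ay)) = inj₁ (⊆A′ (y , Ay , x≡ay))
  from (inj₁ (y , inj₂ By , x≡ay)) = inj₂ (⊆B′ (inj₁ (y , By , x≡ay)))
  from (inj₂ c≡x)                  = inj₂ (⊆B′ (inj₂ c≡x))

module _ {A : Pred ℕ 0ℓ} {a c : ℕ} where

  ⟨·∪｛｝⟩-elements : ⟨ a · A ∪ ｛ c ｝ ⟩ x → ∃₂ λ t m → ⟨ A ⟩ t × x ≡ a * t + c * m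
  ⟨·∪｛｝⟩-elements gen-zero = 0 , 0 , gen-zero , sym (cong₂ _+_ (*-zeroʳ a) (*-zeroʳ c))
  ⟨·∪｛｝⟩-elements (gen-add gen rest) with ⟨·∪｛｝⟩-elements rest
  ... | t , m , At , refl with gen
  ...   | inj₁ (y , Ay , refl) = y + t , m , ⟨⟩-+ (⟨⟩-gen Ay) At , regroup a c y t m
    where
    regroup : ∀ a c y t m → a * y + (a * t + c * m) ≡ a * (y + t) + c * m
    regroup = solve-∀
  ...   | inj₂ refl = t , suc m , At , regroup a c t m
    where
    regroup : ∀ a c t m → c + (a * t + c * m) ≡ a * t + c * suc m
    regroup = solve-∀

  ⟨·∪｛｝⟩-scaled : ⟨ A ⟩ t → ⟨ a · A ∪ ｛ c ｝ ⟩ (a * t)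
  ⟨·∪｛｝⟩-scaled gen-zero = subst ⟨ _ ⟩ (sym (*-zeroʳ a)) gen-zero
  ⟨·∪｛｝⟩-scaled (gen-add {y} {t} Ay p) =
    subst ⟨ _ ⟩ (sym (*-distribˡ-+ a y t)) (gen-add (inj₁ (y , Ay , refl)) (⟨·∪｛｝⟩-scaled p))

  ⟨·∪｛｝⟩-combination : ⟨ A ⟩ t → ∀ m → ⟨ a · A ∪ ｛ c ｝ ⟩ (a * t + c * m)
  ⟨·∪｛｝⟩-combination At m =
    ⟨⟩-+ (⟨·∪｛｝⟩-scaled At) (subst ⟨ _ ⟩ (*-comm m c) (⟨⟩-* m (⟨⟩-gen (inj₂ refl))))

glue-conductor : 0 < a → 0 < c → Coprime a c → ⟨ A ⟩ c →
  IsConductor ⟨ A ⟩ g → IsConductor ⟨ a · A ∪ ｛ c ｝ ⟩ (a * g + (a ∸ 1) * (c ∸ 1))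
glue-conductor {a@(suc a′)} {c@(suc c′)} {A} {g} 0<a 0<c coprime c∈⟨A⟩ (above , below) =
  member , nonmember
  where
  member : ∀ {x} → a * g + a′ * c′ ≤ x → ⟨ a · A ∪ ｛ c ｝ ⟩ x
  member bound with representable-above 0<a 0<c coprime bound
  ... | t , m , g≤t , _ , refl = ⟨·∪｛｝⟩-combination {A} {a} {c} (above g≤t) m
  nonmember : ∀ {h} → suc h ≡ a * g + a′ * c′ → h ∉ ⟨ a · A ∪ ｛ c ｝ ⟩
  nonmember 1+h≡ h∈ with ⟨·∪｛｝⟩-elements {A} {a} {c} h∈
  ... | t , m , At , h≡at+cm =
    below (proj₁ (conductor-predecessor {t = t} {m = m} 0<c coprime 1+h≡ h≡at+cm))
      (⟨⟩-+ At (subst ⟨ A ⟩ (*-comm (m / a) c) (⟨⟩-* (m / a) c∈⟨A⟩)))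

glue : 0 < a → 0 < c → Coprime a c → ⟨ A ⟩ c → IsFrobenius ⟨ A ⟩ F →
  IsFrobenius ⟨ a · A ∪ ｛ c ｝ ⟩ (+ a ℤ.* F ℤ.+ (+ a ℤ.- + 1) ℤ.* + c)
glue {a@(suc a′)} {c@(suc c′)} 0<a 0<c coprime c∈⟨A⟩ frobenius
  with IsFrobenius⇒IsConductor frobenius
... | g , refl , conductor =
  subst (IsFrobenius _) shift
    (IsConductor⇒IsFrobenius (glue-conductor 0<a 0<c coprime c∈⟨A⟩ conductor))
  where
  open ≡-Reasoning
  regroup : ∀ A′ C′ G → ((+ 1 ℤ.+ A′) ℤ.* G ℤ.+ A′ ℤ.* C′) ℤ.- + 1
    ≡ (+ 1 ℤ.+ A′) ℤ.* (G ℤ.- + 1) ℤ.+ ((+ 1 ℤ.+ A′) ℤ.- + 1) ℤ.* (+ 1 ℤ.+ C′)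
  regroup = ℤ-solve-∀
  shift : + (a * g + a′ * c′) ℤ.- + 1 ≡ + a ℤ.* (+ g ℤ.- + 1) ℤ.+ (+ a ℤ.- + 1) ℤ.* + c
  shift = begin
    + (a * g + a′ * c′) ℤ.- + 1             ≡⟨ cong (ℤ._- + 1) (pos-+ (a * g) (a′ * c′)) ⟩
    (+ (a * g) ℤ.+ + (a′ * c′)) ℤ.- + 1      ≡⟨ cong₂ (λ u v → (u ℤ.+ v) ℤ.- + 1) (pos-* a g) (pos-* a′ c′) ⟩
    (+ a ℤ.* + g ℤ.+ + a′ ℤ.* + c′) ℤ.- + 1 ≡⟨ regroup (+ a′) (+ c′) (+ g) ⟩
    + a ℤ.* (+ g ℤ.- + 1) ℤ.+ (+ a ℤ.- + 1) ℤ.* + c ∎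

gluedFrobenius : ℕ → (ℕ → ℕ) → ℤ → ℕ → ℤ
gluedFrobenius a c F₀ zero    = F₀
gluedFrobenius a c F₀ (suc m) = + a ℤ.* gluedFrobenius a c F₀ m ℤ.+ (+ a ℤ.- + 1) ℤ.* + c m

glue-tower : (T : ℕ → Pred ℕ 0ℓ) (c : ℕ → ℕ) → 0 < a → (∀ m → 0 < c m) →
  (∀ m → Coprime a (c m)) → (∀ m → ⟨ T m ⟩ (c m)) → (∀ m → T (suc m) ≐ a · T m ∪ ｛ c m ｝) →
  IsFrobenius ⟨ T 0 ⟩ F → ∀ m → IsFrobenius ⟨ T m ⟩ (gluedFrobenius a c F m)
glue-tower T c 0<a 0<c coprime c∈⟨T⟩ step frobenius zero = frobenius
glue-tower T c 0<a 0<c coprime c∈⟨T⟩ step frobenius (suc m) =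
  IsFrobenius-resp-≐ (≐-sym (⟨⟩-resp-≐ (step m)))
    (glue 0<a (0<c m) (coprime m) (c∈⟨T⟩ m) (glue-tower T c 0<a 0<c coprime c∈⟨T⟩ step frobenius m))

-- Semigroups generated by an arithmetic sequence

Arithmetic : ℕ → ℕ → ℕ → Pred ℕ 0ℓ
Arithmetic a d k x = ∃[ j ] j ≤ k × x ≡ a + j * d

module _ {a d k : ℕ} where

  ⟨Arithmetic⟩-elements : ⟨ Arithmetic a d k ⟩ x → ∃₂ λ m s → s ≤ k * m × x ≡ a * m + d * s
  ⟨Arithmetic⟩-elements gen-zero = 0 , 0 , z≤n , sym (cong₂ _+_ (*-zeroʳ a) (*-zeroʳ d))
  ⟨Arithmetic⟩-elements (gen-add (j , j≤k , refl) rest) with ⟨Arithmetic⟩-elements rest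
  ... | m , s , s≤km , refl =
    suc m , j + s , subst (j + s ≤_) (sym (*-suc k m)) (+-mono-≤ j≤k s≤km) , regroup a d j m s
    where
    regroup : ∀ a d j m s → a + j * d + (a * m + d * s) ≡ a * suc m + d * (j + s)
    regroup = solve-∀

  ⟨Arithmetic⟩-combination : ∀ m s → s ≤ k * m → ⟨ Arithmetic a d k ⟩ (a * m + d * s)
  ⟨Arithmetic⟩-combination zero s s≤0 rewrite n≤0⇒n≡0 (subst (s ≤_) (*-zeroʳ k) s≤0)
    = subst ⟨ _ ⟩ (sym (cong₂ _+_ (*-zeroʳ a) (*-zeroʳ d))) gen-zero
  ⟨Arithmetic⟩-combination (suc m) s s≤k[1+m] with s ≤? k
  ... | yes s≤k =
    subst ⟨ _ ⟩ (regroup a d s m) (gen-add (s , s≤k , refl) (⟨Arithmetic⟩-combination m 0 z≤n))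
    where
    regroup : ∀ a d s m → a + s * d + (a * m + d * 0) ≡ a * suc m + d * s
    regroup = solve-∀
  ... | no s≰k with m≤n⇒∃[o]m+o≡n (<⇒≤ (≰⇒> s≰k))
  ...   | r , refl =
    subst ⟨ _ ⟩ (regroup a d k m r) (gen-add (k , ≤-refl , refl) (⟨Arithmetic⟩-combination m r r≤km))
    where
    regroup : ∀ a d k m r → a + k * d + (a * m + d * r) ≡ a * suc m + d * (k + r)
    regroup = solve-∀
    r≤km : r ≤ k * m
    r≤km = +-cancelˡ-≤ k r (k * m) (subst (k + r ≤_) (*-suc k m) s≤k[1+m])

arithmetic-conductor : .{{_ : ℕ.NonZero a}} → 0 < d → Coprime a d →
  ∀ {C k} → a ∸ 1 ≤ C * k → C * k < (a ∸ 1) + k →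
  IsConductor ⟨ Arithmetic a d k ⟩ (a * C + (a ∸ 1) * (d ∸ 1))
arithmetic-conductor {a = a@(suc a′)} {d} 0<d coprime {C} {k} a′≤Ck Ck<a′+k =
  member , nonmember
  where
  member : ∀ {x} → a * C + a′ * (d ∸ 1) ≤ x → ⟨ Arithmetic a d k ⟩ x
  member bound with representable-above z<s 0<d coprime bound
  ... | t , s , C≤t , s<a , refl = ⟨Arithmetic⟩-combination t s (begin
    s      ≤⟨ ≤-pred s<a ⟩
    a′     ≤⟨ a′≤Ck ⟩
    C * k  ≤⟨ *-monoˡ-≤ k C≤t ⟩
    t * k  ≡⟨ *-comm t k ⟩
    k * t  ∎)
    where open ≤-Reasoning
  nonmember : ∀ {h} → suc h ≡ a * C + a′ * (d ∸ 1) → h ∉ ⟨ Arithmetic a d k ⟩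
  nonmember 1+h≡ h∈ with ⟨Arithmetic⟩-elements h∈
  ... | m , s , s≤km , h≡am+ds
    with conductor-predecessor {t = m} {m = s} 0<d coprime 1+h≡ h≡am+ds
  ... | 1+u≡C , s%a≡a′ = <-irrefl refl (begin-strict
    a′                    ≡⟨ sym s%a≡a′ ⟩
    s % a                 ≤⟨ m%n≤m s a ⟩
    s                     ≤⟨ s≤km ⟩
    k * m                 ≤⟨ *-monoʳ-≤ k (m≤m+n m (d * (s / a))) ⟩
    k * (m + d * (s / a)) ≡⟨ *-comm k _ ⟩
    (m + d * (s / a)) * k <⟨ +-cancelˡ-< k _ a′
                               (subst₂ _<_ (cong (_* k) (sym 1+u≡C)) (+-comm a′ k) Ck<a′+k) ⟩
    a′                    ∎)
    where open ≤-Reasoning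

⌈/⌉-bounds : ∀ n b → 0 < b → n ≤ ⌈ n / b ⌉ * b × ⌈ n / b ⌉ * b < n + b
⌈/⌉-bounds n b@(suc b′) _ = lower , upper
  where
  open ≤-Reasoning
  q : ℕ
  q = ⌈ n / b ⌉
  division : n + b′ ≡ (n + b′) % b + q * b
  division = m≡m%n+[m/n]*n (n + b′) b
  lower : n ≤ q * b
  lower = +-cancelʳ-≤ b′ n (q * b) (begin
    n + b′                ≡⟨ division ⟩
    (n + b′) % b + q * b  ≤⟨ +-monoˡ-≤ (q * b) (≤-pred (m%n<n (n + b′) b)) ⟩
    b′ + q * b            ≡⟨ +-comm b′ (q * b) ⟩
    q * b + b′            ∎)
  upper : q * b < n + b
  upper = begin-strict
    q * b                 ≤⟨ m≤n+m (q * b) ((n + b′) % b) ⟩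
    (n + b′) % b + q * b  ≡⟨ sym division ⟩
    n + b′                <⟨ +-monoʳ-< n (n<1+n b′) ⟩
    n + b                 ∎

-- The semigroups S, S₁ and S₂

baseFrobenius : ℕ → ℕ → ℕ → ℤ
baseFrobenius a b d = + (a * ⌈ (a ∸ 1) * d / b ⌉) ℤ.+ + (a * d) ℤ.- + a ℤ.- + d

GenS-1≐Arithmetic : ∀ {a b d} k → 0 < d → b ≡ k * d → GenS a b d 1 ≐ Arithmetic a d k
GenS-1≐Arithmetic {a} {b} {d} k 0<d b≡kd = to , from
  where
  unit : ∀ j → a * 1 + j * 1 * d ≡ a + j * d
  unit j = cong₂ (λ u v → u + v * d) (*-identityʳ a) (*-identityʳ j)
  to : GenS a b d 1 ⊆ Arithmetic a d k
  to (j , jd≤b , x≡) =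
    j , *-cancelʳ-≤ j k d {{>-nonZero 0<d}} (subst (j * d ≤_) b≡kd jd≤b) , trans x≡ (unit j)
  from : Arithmetic a d k ⊆ GenS a b d 1
  from (j , j≤k , x≡) =
    j , subst (j * d ≤_) (sym b≡kd) (*-monoˡ-≤ d j≤k) , trans x≡ (sym (unit j))

GenS-1-frobenius : 0 < a → 0 < b → 0 < d → b ≡ k * d → Coprime a b →
  IsFrobenius ⟨ GenS a b d 1 ⟩ (baseFrobenius a b d)
GenS-1-frobenius {a@(suc a′)} {b} {d@(suc d′)} {k} _ 0<b _ b≡kd coprime =
  IsFrobenius-resp-≐ (≐-sym (⟨⟩-resp-≐ (GenS-1≐Arithmetic k z<s b≡kd)))
    (subst (IsFrobenius _) shift
      (IsConductor⇒IsFrobenius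
        (arithmetic-conductor z<s (coprime-∣ʳ coprime (divides k b≡kd)) {C} lower upper)))
  where
  -- With b = k d this is ⌈(a − 1)/k⌉, the least C with a − 1 ≤ C k.
  C : ℕ
  C = ⌈ a′ * d / b ⌉
  bounds : a′ * d ≤ C * b × C * b < a′ * d + b
  bounds = ⌈/⌉-bounds (a′ * d) b 0<b
  Cb≡Ckd : C * b ≡ C * k * d
  Cb≡Ckd = trans (cong (C *_) b≡kd) (sym (*-assoc C k d))
  lower : a′ ≤ C * k
  lower = *-cancelʳ-≤ a′ (C * k) d (subst (a′ * d ≤_) Cb≡Ckd (proj₁ bounds))
  upper : C * k < a′ + k
  upper = *-cancelʳ-< d (C * k) (a′ + k)
    (subst₂ _<_ Cb≡Ckd (trans (cong (λ n → a′ * d + n) b≡kd) (sym (*-distribʳ-+ d a′ k)))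
      (proj₂ bounds))
  open ≡-Reasoning
  regroup : ∀ X A′ D′ → (X ℤ.+ A′ ℤ.* D′) ℤ.- + 1
    ≡ X ℤ.+ (+ 1 ℤ.+ A′) ℤ.* (+ 1 ℤ.+ D′) ℤ.- (+ 1 ℤ.+ A′) ℤ.- (+ 1 ℤ.+ D′)
  regroup = ℤ-solve-∀
  shift : + (a * C + a′ * d′) ℤ.- + 1 ≡ baseFrobenius a b d
  shift = begin
    + (a * C + a′ * d′) ℤ.- + 1          ≡⟨ cong (ℤ._- + 1) (pos-+ (a * C) (a′ * d′)) ⟩
    (+ (a * C) ℤ.+ + (a′ * d′)) ℤ.- + 1   ≡⟨ cong (λ u → (+ (a * C) ℤ.+ u) ℤ.- + 1) (pos-* a′ d′) ⟩
    (+ (a * C) ℤ.+ + a′ ℤ.* + d′) ℤ.- + 1 ≡⟨ regroup (+ (a * C)) (+ a′) (+ d′) ⟩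
    + (a * C) ℤ.+ + a ℤ.* + d ℤ.- + a ℤ.- + d ≡⟨ cong (λ u → + (a * C) ℤ.+ u ℤ.- + a ℤ.- + d) (sym (pos-* a d)) ⟩
    baseFrobenius a b d ∎

GenS-step : ∀ {a b d} m → GenS a b d (2 + m) ≐ a · GenS a b d (1 + m)
GenS-step {a} {b} {d} m = to , from
  where
  scale : ∀ a P j d → a * (a * P) + j * (a * P) * d ≡ a * (a * P + j * P * d)
  scale = solve-∀
  to : GenS a b d (2 + m) ⊆ a · GenS a b d (1 + m)
  to (j , jd≤b , x≡) = _ , (j , jd≤b , refl) , trans x≡ (scale a (a ^ m) j d)
  from : a · GenS a b d (1 + m) ⊆ GenS a b d (2 + m)
  from (_ , (j , jd≤b , y≡) , x≡ay) =
    j , jd≤b , trans x≡ay (trans (cong (a *_) y≡) (sym (scale a (a ^ m) j d)))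

GenS-first : ∀ {a b d} m → GenS a b d (suc m) (a ^ suc m)
GenS-first {a} m = 0 , z≤n , sym (+-identityʳ (a ^ suc m))

Extra : (ℕ → ℕ → ℕ) → ℕ → Pred ℕ 0ℓ
Extra e n x = ∃[ k ] 2 ≤ k × k ≤ n × x ≡ e n k

∪-Extra-1 : ∀ {e} → A ∪ Extra e 1 ≐ A
∪-Extra-1 = [ id , (λ { (k , 2≤k , k≤1 , _) → contradiction (≤-trans 2≤k k≤1) (λ { (s≤s ()) }) }) ]
          , inj₁

Extra-step : ∀ {e} m → (∀ {k} → k ≤ 1 + m → e (2 + m) k ≡ a * e (1 + m) k) →
  e (2 + m) (2 + m) ≡ c → Extra e (2 + m) ≐ a · Extra e (1 + m) ∪ ｛ c ｝
Extra-step {a} {c} {e} m scale top = to , from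
  where
  to : Extra e (2 + m) ⊆ a · Extra e (1 + m) ∪ ｛ c ｝
  to (k , 2≤k , k≤2+m , x≡) with k ≤? 1 + m
  ... | yes k≤1+m = inj₁ (e (1 + m) k , (k , 2≤k , k≤1+m , refl) , trans x≡ (scale k≤1+m))
  ... | no k≰1+m with ≤-antisym k≤2+m (≰⇒> k≰1+m)
  ...   | refl = inj₂ (trans (sym top) (sym x≡))
  from : a · Extra e (1 + m) ∪ ｛ c ｝ ⊆ Extra e (2 + m)
  from (inj₁ (_ , (k , 2≤k , k≤1+m , y≡) , x≡ay)) =
    k , 2≤k , m≤n⇒m≤1+n k≤1+m , trans x≡ay (trans (cong (a *_) y≡) (sym (scale k≤1+m)))
  from (inj₂ refl) = 2 + m , s≤s (s≤s z≤n) , ≤-refl , sym top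

-- GenS₁ a b d n and GenS₂ a b d n are, definitionally, GenS a b d n ∪ Extra (extra₁ a b) n
-- and GenS a b d n ∪ Extra (extra₂ a b) n.
extra₁ : ℕ → ℕ → ℕ → ℕ → ℕ
extra₁ a b n k = a ^ n + a ^ (n ∸ k) * b ^ k

extra₂ : ℕ → ℕ → ℕ → ℕ → ℕ
extra₂ a b n j = a ^ n + partialSum a b n j

fullSum : ℕ → ℕ → ℕ → ℕ
fullSum a b n = partialSum a b n n

^-suc-∸ : ∀ a {n k} → k ≤ n → a ^ (suc n ∸ k) ≡ a * a ^ (n ∸ k)
^-suc-∸ a k≤n = cong (a ^_) (+-∸-assoc 1 k≤n)

extra₁-scale : ∀ a b {n k} → k ≤ n → extra₁ a b (suc n) k ≡ a * extra₁ a b n k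
extra₁-scale a b {n} {k} k≤n =
  trans (cong (λ u → a * a ^ n + u * b ^ k) (^-suc-∸ a k≤n)) (regroup a (a ^ n) (a ^ (n ∸ k)) (b ^ k))
  where
  regroup : ∀ a P R Q → a * P + a * R * Q ≡ a * (P + R * Q)
  regroup = solve-∀

extra₁-diagonal : ∀ a b n → extra₁ a b n n ≡ a ^ n + b ^ n
extra₁-diagonal a b n =
  trans (cong (λ u → a ^ n + a ^ u * b ^ n) (n∸n≡0 n)) (cong (λ u → a ^ n + u) (*-identityˡ (b ^ n)))

partialSum-scale : ∀ a b {n j} → j ≤ n → partialSum a b (suc n) j ≡ a * partialSum a b n j
partialSum-scale a b {n} {zero}  _    = sym (*-zeroʳ a)
partialSum-scale a b {n} {suc j} j<n =
  trans (cong₂ (λ u v → u + v * b ^ suc j) (partialSum-scale a b (<⇒≤ j<n)) (^-suc-∸ a j<n))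
        (regroup a (partialSum a b n j) (a ^ (n ∸ suc j)) (b ^ suc j))
  where
  regroup : ∀ a S R Q → a * S + a * R * Q ≡ a * (S + R * Q)
  regroup = solve-∀

extra₂-scale : ∀ a b {n j} → j ≤ n → extra₂ a b (suc n) j ≡ a * extra₂ a b n j
extra₂-scale a b {n} j≤n =
  trans (cong (λ u → a * a ^ n + u) (partialSum-scale a b j≤n)) (sym (*-distribˡ-+ a (a ^ n) _))

fullSum-suc : ∀ a b n → fullSum a b (suc n) ≡ a * fullSum a b n + b ^ suc n
fullSum-suc a b n = cong₂ _+_ (partialSum-scale a b {n} ≤-refl)
  (trans (cong (λ u → a ^ u * b ^ suc n) (n∸n≡0 n)) (*-identityˡ (b ^ suc n)))

fullSum-suc′ : ∀ a b n → fullSum a b (suc n) ≡ b * (a ^ n + fullSum a b n)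
fullSum-suc′ a b zero    = base b
  where
  base : ∀ b → 0 + 1 * (b * 1) ≡ b * (1 + 0)
  base = solve-∀
fullSum-suc′ a b (suc n) = begin
  fullSum a b (2 + n)                                ≡⟨ fullSum-suc a b (suc n) ⟩
  a * fullSum a b (suc n) + b ^ (2 + n)              ≡⟨ cong (λ u → a * u + b ^ (2 + n)) (fullSum-suc′ a b n) ⟩
  a * (b * (a ^ n + fullSum a b n)) + b * b ^ suc n  ≡⟨ regroup a b (a ^ n) (fullSum a b n) (b ^ suc n) ⟩
  b * (a ^ suc n + (a * fullSum a b n + b ^ suc n))  ≡⟨ cong (λ u → b * (a ^ suc n + u)) (sym (fullSum-suc a b n)) ⟩
  b * (a ^ suc n + fullSum a b (suc n))              ∎
  where
  open ≡-Reasoning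
  regroup : ∀ a b P S Q → a * (b * (P + S)) + b * Q ≡ b * (a * P + (a * S + Q))
  regroup = solve-∀

top₁ : ℕ → ℕ → ℕ → ℕ
top₁ a b n = a ^ n + b ^ n

top₂ : ℕ → ℕ → ℕ → ℕ
top₂ a b n = a ^ n + fullSum a b n

top₂-suc : ∀ a b n → top₂ a b (suc n) ≡ a * (a ^ n + fullSum a b n) + b ^ suc n
top₂-suc a b n = trans (cong (λ u → a * a ^ n + u) (fullSum-suc a b n))
  (regroup a (a ^ n) (fullSum a b n) (b ^ suc n))
  where
  regroup : ∀ a P S Q → a * P + (a * S + Q) ≡ a * (P + S) + Q
  regroup = solve-∀

^+-positive : 0 < a → ∀ n x → 0 < a ^ n + x
^+-positive 0<a n x = ≤-trans (m^n>0 _ {{>-nonZero 0<a}} n) (m≤m+n _ x)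

module _ {a b d k : ℕ} (b≡kd : b ≡ k * d) where

  GenS-last : GenS a b d 1 (a * 1 + b)
  GenS-last =
    k , ≤-reflexive (sym b≡kd) , cong (λ u → a * 1 + u) (trans b≡kd (cong (_* d) (sym (*-identityʳ k))))

  top₁-generator : ∀ m → GenS₁ a b d (suc m) (top₁ a b (suc m))
  top₁-generator zero    =
    inj₁ (subst (GenS a b d 1) (cong (λ u → a * 1 + u) (sym (*-identityʳ b))) GenS-last)
  top₁-generator (suc m) = inj₂ (2 + m , s≤s (s≤s z≤n) , ≤-refl , sym (extra₁-diagonal a b (2 + m)))

  top₂-generator : ∀ m → GenS₂ a b d (suc m) (top₂ a b (suc m))
  top₂-generator zero    =
    inj₁ (subst (GenS a b d 1) (cong (λ u → a * 1 + u) (sym (fullSum-1 b))) GenS-last)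
    where
    fullSum-1 : ∀ b → 0 + 1 * (b * 1) ≡ b
    fullSum-1 = solve-∀
  top₂-generator (suc m) = inj₂ (2 + m , s≤s (s≤s z≤n) , ≤-refl , refl)

  GenS₁-step : ∀ m → GenS₁ a b d (2 + m) ≐ a · GenS₁ a b d (1 + m) ∪ ｛ top₁ a b (2 + m) ｝
  GenS₁-step m = ∪-step {a = a} (GenS-step m)
    (Extra-step {a = a} {e = extra₁ a b} m (extra₁-scale a b) (extra₁-diagonal a b (2 + m)))

  GenS₂-step : ∀ m → GenS₂ a b d (2 + m) ≐ a · GenS₂ a b d (1 + m) ∪ ｛ top₂ a b (2 + m) ｝
  GenS₂-step m = ∪-step {a = a} (GenS-step m)
    (Extra-step {a = a} {e = extra₂ a b} m (extra₂-scale a b) refl)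

  -- a²⁺ᵐ + b²⁺ᵐ = (a − b) a¹⁺ᵐ + b (a¹⁺ᵐ + b¹⁺ᵐ): the only use of b ≤ a.
  top₁∈⟨GenS₁⟩ : b ≤ a → ∀ m → ⟨ GenS₁ a b d (suc m) ⟩ (top₁ a b (2 + m))
  top₁∈⟨GenS₁⟩ b≤a m with m≤n⇒∃[o]m+o≡n b≤a
  ... | δ , refl = subst ⟨ _ ⟩ (regroup ((b + δ) ^ suc m) b δ (b ^ suc m))
    (⟨⟩-+ (⟨⟩-* δ (⟨⟩-gen (inj₁ (GenS-first m)))) (⟨⟩-* b (⟨⟩-gen (top₁-generator m))))
    where
    regroup : ∀ P b δ Q → δ * P + b * (P + Q) ≡ (b + δ) * P + b * Q
    regroup = solve-∀

  top₂∈⟨GenS₂⟩ : ∀ m → ⟨ GenS₂ a b d (suc m) ⟩ (top₂ a b (2 + m))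
  top₂∈⟨GenS₂⟩ m = subst ⟨ _ ⟩ (cong (λ u → a ^ (2 + m) + u) (sym (fullSum-suc′ a b (suc m))))
    (⟨⟩-+ (⟨⟩-* a (⟨⟩-gen (inj₁ (GenS-first m)))) (⟨⟩-* b (⟨⟩-gen (top₂-generator m))))

module _ {a b d k : ℕ} (0<a : 0 < a) (0<b : 0 < b) (0<d : 0 < d) (b≡kd : b ≡ k * d)
         (coprime : Coprime a b) where

  GenS₁-frobenius : b ≤ a → ∀ m → IsFrobenius ⟨ GenS₁ a b d (suc m) ⟩
    (gluedFrobenius a (λ m → top₁ a b (2 + m)) (baseFrobenius a b d) m)
  GenS₁-frobenius b≤a = glue-tower (λ m → GenS₁ a b d (suc m)) (λ m → top₁ a b (2 + m)) 0<a
    (λ m → ^+-positive 0<a (2 + m) _) (λ m → coprime-*+ (coprime-^ coprime (2 + m)) (a ^ suc m))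
    (top₁∈⟨GenS₁⟩ {a} {b} {d} {k} b≡kd b≤a) (GenS₁-step {a} {b} {d} {k} b≡kd)
    (IsFrobenius-resp-≐ (≐-sym (⟨⟩-resp-≐ (∪-Extra-1 {e = extra₁ a b})))
      (GenS-1-frobenius {k = k} 0<a 0<b 0<d b≡kd coprime))

  GenS₂-frobenius : ∀ m → IsFrobenius ⟨ GenS₂ a b d (suc m) ⟩
    (gluedFrobenius a (λ m → top₂ a b (2 + m)) (baseFrobenius a b d) m)
  GenS₂-frobenius = glue-tower (λ m → GenS₂ a b d (suc m)) (λ m → top₂ a b (2 + m)) 0<a
    (λ m → ^+-positive 0<a (2 + m) _)
    (λ m → subst (Coprime a) (sym (top₂-suc a b (suc m))) (coprime-*+ (coprime-^ coprime (2 + m)) _))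
    (top₂∈⟨GenS₂⟩ {a} {b} {d} {k} b≡kd) (GenS₂-step {a} {b} {d} {k} b≡kd)
    (IsFrobenius-resp-≐ (≐-sym (⟨⟩-resp-≐ (∪-Extra-1 {e = extra₂ a b})))
      (GenS-1-frobenius {k = k} 0<a 0<b 0<d b≡kd coprime))

-- Closed forms

pos-^ : ∀ a n → + (a ^ n) ≡ (+ a) ℤ.^ n
pos-^ a zero    = refl
pos-^ a (suc n) = trans (pos-* a (a ^ n)) (cong ((+ a) ℤ.*_) (pos-^ a n))

module _ {α β : ℤ} {G : ℕ → ℤ} where

  open ≡-Reasoning

  top₁-recurrence-solution :
    (∀ m → G (suc m) ≡ α ℤ.* G m ℤ.+ (α ℤ.- + 1) ℤ.* (α ℤ.^ (2 + m) ℤ.+ β ℤ.^ (2 + m))) →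
    ∀ m → (G m ℤ.- α ℤ.^ m ℤ.* G 0) ℤ.* (α ℤ.- β)
        ≡ (α ℤ.- + 1) ℤ.* (+ m ℤ.* α ℤ.^ suc m ℤ.* (α ℤ.- β) ℤ.+ β ℤ.^ 2 ℤ.* (α ℤ.^ m ℤ.- β ℤ.^ m))
  top₁-recurrence-solution G-suc zero = vanish α β (G 0)
    where
    vanish : ∀ α β X → (X ℤ.- + 1 ℤ.* X) ℤ.* (α ℤ.- β)
      ≡ (α ℤ.- + 1) ℤ.* (+ 0 ℤ.* (α ℤ.* + 1) ℤ.* (α ℤ.- β) ℤ.+ β ℤ.* (β ℤ.* + 1) ℤ.* (+ 1 ℤ.- + 1))
    vanish = ℤ-solve-∀
  top₁-recurrence-solution G-suc (suc m) = begin
    (G (suc m) ℤ.- α ℤ.* P ℤ.* G 0) ℤ.* (α ℤ.- β)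
      ≡⟨ cong (λ u → (u ℤ.- α ℤ.* P ℤ.* G 0) ℤ.* (α ℤ.- β)) (G-suc m) ⟩
    (α ℤ.* G m ℤ.+ (α ℤ.- + 1) ℤ.* (α ℤ.* (α ℤ.* P) ℤ.+ β ℤ.* (β ℤ.* Q)) ℤ.- α ℤ.* P ℤ.* G 0) ℤ.* (α ℤ.- β)
      ≡⟨ expand α β P Q (G m) (G 0) ⟩
    α ℤ.* ((G m ℤ.- P ℤ.* G 0) ℤ.* (α ℤ.- β))
      ℤ.+ (α ℤ.- + 1) ℤ.* (α ℤ.* (α ℤ.* P) ℤ.+ β ℤ.* (β ℤ.* Q)) ℤ.* (α ℤ.- β)
      ≡⟨ cong (λ u → α ℤ.* u ℤ.+ (α ℤ.- + 1) ℤ.* (α ℤ.* (α ℤ.* P) ℤ.+ β ℤ.* (β ℤ.* Q)) ℤ.* (α ℤ.- β))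
              (top₁-recurrence-solution G-suc m) ⟩
    α ℤ.* ((α ℤ.- + 1) ℤ.* (+ m ℤ.* (α ℤ.* P) ℤ.* (α ℤ.- β) ℤ.+ β ℤ.* (β ℤ.* + 1) ℤ.* (P ℤ.- Q)))
      ℤ.+ (α ℤ.- + 1) ℤ.* (α ℤ.* (α ℤ.* P) ℤ.+ β ℤ.* (β ℤ.* Q)) ℤ.* (α ℤ.- β)
      ≡⟨ collect α β (+ m) P Q ⟩
    (α ℤ.- + 1) ℤ.* ((+ 1 ℤ.+ + m) ℤ.* (α ℤ.* (α ℤ.* P)) ℤ.* (α ℤ.- β)
      ℤ.+ β ℤ.* (β ℤ.* + 1) ℤ.* (α ℤ.* P ℤ.- β ℤ.* Q)) ∎
    where
    P Q : ℤ
    P = α ℤ.^ m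
    Q = β ℤ.^ m
    expand : ∀ α β P Q G X →
      (α ℤ.* G ℤ.+ (α ℤ.- + 1) ℤ.* (α ℤ.* (α ℤ.* P) ℤ.+ β ℤ.* (β ℤ.* Q)) ℤ.- α ℤ.* P ℤ.* X) ℤ.* (α ℤ.- β)
      ≡ α ℤ.* ((G ℤ.- P ℤ.* X) ℤ.* (α ℤ.- β))
        ℤ.+ (α ℤ.- + 1) ℤ.* (α ℤ.* (α ℤ.* P) ℤ.+ β ℤ.* (β ℤ.* Q)) ℤ.* (α ℤ.- β)
    expand = ℤ-solve-∀
    collect : ∀ α β M P Q →
      α ℤ.* ((α ℤ.- + 1) ℤ.* (M ℤ.* (α ℤ.* P) ℤ.* (α ℤ.- β) ℤ.+ β ℤ.* (β ℤ.* + 1) ℤ.* (P ℤ.- Q)))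
        ℤ.+ (α ℤ.- + 1) ℤ.* (α ℤ.* (α ℤ.* P) ℤ.+ β ℤ.* (β ℤ.* Q)) ℤ.* (α ℤ.- β)
      ≡ (α ℤ.- + 1) ℤ.* ((+ 1 ℤ.+ M) ℤ.* (α ℤ.* (α ℤ.* P)) ℤ.* (α ℤ.- β)
        ℤ.+ β ℤ.* (β ℤ.* + 1) ℤ.* (α ℤ.* P ℤ.- β ℤ.* Q))
    collect = ℤ-solve-∀

  top₂-recurrence-solution : {H : ℕ → ℤ} →
    (∀ n → (α ℤ.- β) ℤ.* H n ≡ β ℤ.* (α ℤ.^ n ℤ.- β ℤ.^ n)) →
    (∀ m → G (suc m) ≡ α ℤ.* G m ℤ.+ (α ℤ.- + 1) ℤ.* (α ℤ.^ (2 + m) ℤ.+ H (2 + m))) →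
    ∀ m → (G m ℤ.- α ℤ.^ m ℤ.* G 0) ℤ.* ((α ℤ.- β) ℤ.* (α ℤ.- β))
        ≡ (α ℤ.- + 1) ℤ.* (+ m ℤ.* α ℤ.^ (2 + m) ℤ.* (α ℤ.- β) ℤ.- β ℤ.^ 3 ℤ.* (α ℤ.^ m ℤ.- β ℤ.^ m))
  top₂-recurrence-solution geometric G-suc zero = vanish α β (G 0)
    where
    vanish : ∀ α β X → (X ℤ.- + 1 ℤ.* X) ℤ.* ((α ℤ.- β) ℤ.* (α ℤ.- β))
      ≡ (α ℤ.- + 1) ℤ.* (+ 0 ℤ.* (α ℤ.* (α ℤ.* + 1)) ℤ.* (α ℤ.- β)
        ℤ.- β ℤ.* (β ℤ.* (β ℤ.* + 1)) ℤ.* (+ 1 ℤ.- + 1))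
    vanish = ℤ-solve-∀
  top₂-recurrence-solution {H} geometric G-suc (suc m) = begin
    (G (suc m) ℤ.- α ℤ.* P ℤ.* G 0) ℤ.* ((α ℤ.- β) ℤ.* (α ℤ.- β))
      ≡⟨ cong (λ u → (u ℤ.- α ℤ.* P ℤ.* G 0) ℤ.* ((α ℤ.- β) ℤ.* (α ℤ.- β))) (G-suc m) ⟩
    (α ℤ.* G m ℤ.+ (α ℤ.- + 1) ℤ.* (α ℤ.* (α ℤ.* P) ℤ.+ H (2 + m)) ℤ.- α ℤ.* P ℤ.* G 0)
      ℤ.* ((α ℤ.- β) ℤ.* (α ℤ.- β))
      ≡⟨ expand α β P (H (2 + m)) (G m) (G 0) ⟩
    α ℤ.* ((G m ℤ.- P ℤ.* G 0) ℤ.* ((α ℤ.- β) ℤ.* (α ℤ.- β)))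
      ℤ.+ (α ℤ.- + 1) ℤ.* (α ℤ.- β) ℤ.* ((α ℤ.- β) ℤ.* (α ℤ.* (α ℤ.* P)) ℤ.+ (α ℤ.- β) ℤ.* H (2 + m))
      ≡⟨ cong₂ (λ u v → α ℤ.* u ℤ.+ (α ℤ.- + 1) ℤ.* (α ℤ.- β) ℤ.* ((α ℤ.- β) ℤ.* (α ℤ.* (α ℤ.* P)) ℤ.+ v))
               (top₂-recurrence-solution geometric G-suc m) (geometric (2 + m)) ⟩
    α ℤ.* ((α ℤ.- + 1) ℤ.* (+ m ℤ.* (α ℤ.* (α ℤ.* P)) ℤ.* (α ℤ.- β)
        ℤ.- β ℤ.* (β ℤ.* (β ℤ.* + 1)) ℤ.* (P ℤ.- Q)))
      ℤ.+ (α ℤ.- + 1) ℤ.* (α ℤ.- β) ℤ.* ((α ℤ.- β) ℤ.* (α ℤ.* (α ℤ.* P))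
        ℤ.+ β ℤ.* (α ℤ.* (α ℤ.* P) ℤ.- β ℤ.* (β ℤ.* Q)))
      ≡⟨ collect α β (+ m) P Q ⟩
    (α ℤ.- + 1) ℤ.* ((+ 1 ℤ.+ + m) ℤ.* (α ℤ.* (α ℤ.* (α ℤ.* P))) ℤ.* (α ℤ.- β)
      ℤ.- β ℤ.* (β ℤ.* (β ℤ.* + 1)) ℤ.* (α ℤ.* P ℤ.- β ℤ.* Q)) ∎
    where
    P Q : ℤ
    P = α ℤ.^ m
    Q = β ℤ.^ m
    expand : ∀ α β P H G X →
      (α ℤ.* G ℤ.+ (α ℤ.- + 1) ℤ.* (α ℤ.* (α ℤ.* P) ℤ.+ H) ℤ.- α ℤ.* P ℤ.* X) ℤ.* ((α ℤ.- β) ℤ.* (α ℤ.- β))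
      ≡ α ℤ.* ((G ℤ.- P ℤ.* X) ℤ.* ((α ℤ.- β) ℤ.* (α ℤ.- β)))
        ℤ.+ (α ℤ.- + 1) ℤ.* (α ℤ.- β) ℤ.* ((α ℤ.- β) ℤ.* (α ℤ.* (α ℤ.* P)) ℤ.+ (α ℤ.- β) ℤ.* H)
    expand = ℤ-solve-∀
    collect : ∀ α β M P Q →
      α ℤ.* ((α ℤ.- + 1) ℤ.* (M ℤ.* (α ℤ.* (α ℤ.* P)) ℤ.* (α ℤ.- β)
          ℤ.- β ℤ.* (β ℤ.* (β ℤ.* + 1)) ℤ.* (P ℤ.- Q)))
        ℤ.+ (α ℤ.- + 1) ℤ.* (α ℤ.- β) ℤ.* ((α ℤ.- β) ℤ.* (α ℤ.* (α ℤ.* P))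
          ℤ.+ β ℤ.* (α ℤ.* (α ℤ.* P) ℤ.- β ℤ.* (β ℤ.* Q)))
      ≡ (α ℤ.- + 1) ℤ.* ((+ 1 ℤ.+ M) ℤ.* (α ℤ.* (α ℤ.* (α ℤ.* P))) ℤ.* (α ℤ.- β)
        ℤ.- β ℤ.* (β ℤ.* (β ℤ.* + 1)) ℤ.* (α ℤ.* P ℤ.- β ℤ.* Q))
    collect = ℤ-solve-∀

top₁-cast : ∀ a b n → + top₁ a b n ≡ (+ a) ℤ.^ n ℤ.+ (+ b) ℤ.^ n
top₁-cast a b n = trans (pos-+ (a ^ n) (b ^ n)) (cong₂ ℤ._+_ (pos-^ a n) (pos-^ b n))

top₂-cast : ∀ a b n → + top₂ a b n ≡ (+ a) ℤ.^ n ℤ.+ + fullSum a b n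
top₂-cast a b n = trans (pos-+ (a ^ n) (fullSum a b n)) (cong (ℤ._+ + fullSum a b n) (pos-^ a n))

fullSum-geometric : ∀ a b n →
  (+ a ℤ.- + b) ℤ.* + fullSum a b n ≡ + b ℤ.* ((+ a) ℤ.^ n ℤ.- (+ b) ℤ.^ n)
fullSum-geometric a b zero = vanish (+ a) (+ b)
  where
  vanish : ∀ α β → (α ℤ.- β) ℤ.* + 0 ≡ β ℤ.* (+ 1 ℤ.- + 1)
  vanish = ℤ-solve-∀
fullSum-geometric a b (suc n) = begin
  (α ℤ.- β) ℤ.* + fullSum a b (suc n)
    ≡⟨ cong ((α ℤ.- β) ℤ.*_) cast ⟩
  (α ℤ.- β) ℤ.* (α ℤ.* + fullSum a b n ℤ.+ β ℤ.* β ℤ.^ n)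
    ≡⟨ expand α β (+ fullSum a b n) (β ℤ.^ n) ⟩
  α ℤ.* ((α ℤ.- β) ℤ.* + fullSum a b n) ℤ.+ (α ℤ.- β) ℤ.* (β ℤ.* β ℤ.^ n)
    ≡⟨ cong (λ u → α ℤ.* u ℤ.+ (α ℤ.- β) ℤ.* (β ℤ.* β ℤ.^ n)) (fullSum-geometric a b n) ⟩
  α ℤ.* (β ℤ.* (α ℤ.^ n ℤ.- β ℤ.^ n)) ℤ.+ (α ℤ.- β) ℤ.* (β ℤ.* β ℤ.^ n)
    ≡⟨ collect α β (α ℤ.^ n) (β ℤ.^ n) ⟩
  β ℤ.* (α ℤ.* α ℤ.^ n ℤ.- β ℤ.* β ℤ.^ n) ∎
  where
  open ≡-Reasoning
  α β : ℤ
  α = + a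
  β = + b
  cast : + fullSum a b (suc n) ≡ α ℤ.* + fullSum a b n ℤ.+ β ℤ.* β ℤ.^ n
  cast = trans (cong +_ (fullSum-suc a b n))
    (trans (pos-+ (a * fullSum a b n) (b ^ suc n))
      (cong₂ ℤ._+_ (pos-* a (fullSum a b n)) (pos-^ b (suc n))))
  expand : ∀ α β H Q →
    (α ℤ.- β) ℤ.* (α ℤ.* H ℤ.+ β ℤ.* Q) ≡ α ℤ.* ((α ℤ.- β) ℤ.* H) ℤ.+ (α ℤ.- β) ℤ.* (β ℤ.* Q)
  expand = ℤ-solve-∀
  collect : ∀ α β P Q →
    α ℤ.* (β ℤ.* (P ℤ.- Q)) ℤ.+ (α ℤ.- β) ℤ.* (β ℤ.* Q) ≡ β ℤ.* (α ℤ.* P ℤ.- β ℤ.* Q)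
  collect = ℤ-solve-∀

gluedFrobenius-top₁ : ∀ a b X m →
  (gluedFrobenius a (λ m → top₁ a b (2 + m)) X m ℤ.- + (a ^ m) ℤ.* X) ℤ.* (+ a ℤ.- + b)
  ≡ (+ a ℤ.- + 1) ℤ.* (+ m ℤ.* + (a ^ suc m) ℤ.* (+ a ℤ.- + b) ℤ.+ + (b ^ 2) ℤ.* (+ (a ^ m) ℤ.- + (b ^ m)))
gluedFrobenius-top₁ a b X m = begin
  (G m ℤ.- + (a ^ m) ℤ.* X) ℤ.* (α ℤ.- β)
    ≡⟨ cong (λ u → (G m ℤ.- u ℤ.* X) ℤ.* (α ℤ.- β)) (pos-^ a m) ⟩
  (G m ℤ.- α ℤ.^ m ℤ.* G 0) ℤ.* (α ℤ.- β)
    ≡⟨ top₁-recurrence-solution {α} {β} {G} G-suc m ⟩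
  (α ℤ.- + 1) ℤ.* (+ m ℤ.* α ℤ.^ suc m ℤ.* (α ℤ.- β) ℤ.+ β ℤ.^ 2 ℤ.* (α ℤ.^ m ℤ.- β ℤ.^ m))
    ≡⟨ cong₂ (λ u v → (α ℤ.- + 1) ℤ.* (+ m ℤ.* u ℤ.* (α ℤ.- β) ℤ.+ v ℤ.* (α ℤ.^ m ℤ.- β ℤ.^ m)))
             (sym (pos-^ a (suc m))) (sym (pos-^ b 2)) ⟩
  (α ℤ.- + 1) ℤ.* (+ m ℤ.* + (a ^ suc m) ℤ.* (α ℤ.- β) ℤ.+ + (b ^ 2) ℤ.* (α ℤ.^ m ℤ.- β ℤ.^ m))
    ≡⟨ cong₂ (λ u v → (α ℤ.- + 1) ℤ.* (+ m ℤ.* + (a ^ suc m) ℤ.* (α ℤ.- β) ℤ.+ + (b ^ 2) ℤ.* (u ℤ.- v)))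
             (sym (pos-^ a m)) (sym (pos-^ b m)) ⟩
  (α ℤ.- + 1) ℤ.* (+ m ℤ.* + (a ^ suc m) ℤ.* (α ℤ.- β) ℤ.+ + (b ^ 2) ℤ.* (+ (a ^ m) ℤ.- + (b ^ m))) ∎
  where
  open ≡-Reasoning
  α β : ℤ
  α = + a
  β = + b
  G : ℕ → ℤ
  G = gluedFrobenius a (λ m → top₁ a b (2 + m)) X
  G-suc : ∀ m → G (suc m) ≡ α ℤ.* G m ℤ.+ (α ℤ.- + 1) ℤ.* (α ℤ.^ (2 + m) ℤ.+ β ℤ.^ (2 + m))
  G-suc m = cong (λ u → α ℤ.* G m ℤ.+ (α ℤ.- + 1) ℤ.* u) (top₁-cast a b (2 + m))

gluedFrobenius-top₂ : ∀ a b X m →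
  (gluedFrobenius a (λ m → top₂ a b (2 + m)) X m ℤ.- + (a ^ m) ℤ.* X) ℤ.* ((+ a ℤ.- + b) ℤ.* (+ a ℤ.- + b))
  ≡ (+ a ℤ.- + 1) ℤ.* (+ m ℤ.* + (a ^ (suc m + 1)) ℤ.* (+ a ℤ.- + b)
      ℤ.- + (b ^ 3) ℤ.* (+ (a ^ m) ℤ.- + (b ^ m)))
gluedFrobenius-top₂ a b X m = begin
  (G m ℤ.- + (a ^ m) ℤ.* X) ℤ.* ((α ℤ.- β) ℤ.* (α ℤ.- β))
    ≡⟨ cong (λ u → (G m ℤ.- u ℤ.* X) ℤ.* ((α ℤ.- β) ℤ.* (α ℤ.- β))) (pos-^ a m) ⟩
  (G m ℤ.- α ℤ.^ m ℤ.* G 0) ℤ.* ((α ℤ.- β) ℤ.* (α ℤ.- β))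
    ≡⟨ top₂-recurrence-solution {α} {β} {G} (fullSum-geometric a b) G-suc m ⟩
  (α ℤ.- + 1) ℤ.* (+ m ℤ.* α ℤ.^ (2 + m) ℤ.* (α ℤ.- β) ℤ.- β ℤ.^ 3 ℤ.* (α ℤ.^ m ℤ.- β ℤ.^ m))
    ≡⟨ cong₂ (λ u v → (α ℤ.- + 1) ℤ.* (+ m ℤ.* u ℤ.* (α ℤ.- β) ℤ.- v ℤ.* (α ℤ.^ m ℤ.- β ℤ.^ m)))
             (sym (trans (cong (λ e → + (a ^ e)) (+-comm (suc m) 1)) (pos-^ a (2 + m)))) (sym (pos-^ b 3)) ⟩
  (α ℤ.- + 1) ℤ.* (+ m ℤ.* + (a ^ (suc m + 1)) ℤ.* (α ℤ.- β) ℤ.- + (b ^ 3) ℤ.* (α ℤ.^ m ℤ.- β ℤ.^ m))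
    ≡⟨ cong₂ (λ u v → (α ℤ.- + 1) ℤ.* (+ m ℤ.* + (a ^ (suc m + 1)) ℤ.* (α ℤ.- β) ℤ.- + (b ^ 3) ℤ.* (u ℤ.- v)))
             (sym (pos-^ a m)) (sym (pos-^ b m)) ⟩
  (α ℤ.- + 1) ℤ.* (+ m ℤ.* + (a ^ (suc m + 1)) ℤ.* (α ℤ.- β) ℤ.- + (b ^ 3) ℤ.* (+ (a ^ m) ℤ.- + (b ^ m))) ∎
  where
  open ≡-Reasoning
  α β : ℤ
  α = + a
  β = + b
  G : ℕ → ℤ
  G = gluedFrobenius a (λ m → top₂ a b (2 + m)) X
  G-suc : ∀ m → G (suc m) ≡ α ℤ.* G m ℤ.+ (α ℤ.- + 1) ℤ.* (α ℤ.^ (2 + m) ℤ.+ + fullSum a b (2 + m))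
  G-suc m = cong (λ u → α ℤ.* G m ℤ.+ (α ℤ.- + 1) ℤ.* u) (top₂-cast a b (2 + m))

theorem1p1 : (a b d n : ℕ) → 0 < a → 0 < b → 0 < d → 0 < n → d ∣ b → gcd a b ≡ 1 →
    ((b ≤ a) →
      Σ ℤ λ F → IsFrobenius ⟨ GenS₁ a b d n ⟩ F
        × ((F ℤ.- firstTerm a b d n) ℤ.* (+ a ℤ.- + b)
            ≡ (+ a ℤ.- + 1) ℤ.* (+ (n ∸ 1) ℤ.* + (a ^ n) ℤ.* (+ a ℤ.- + b)
                 ℤ.+ + (b ^ 2) ℤ.* (+ (a ^ (n ∸ 1)) ℤ.- + (b ^ (n ∸ 1))))))
    × (Σ ℤ λ F → IsFrobenius ⟨ GenS₂ a b d n ⟩ F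
        × ((F ℤ.- firstTerm a b d n) ℤ.* ((+ a ℤ.- + b) ℤ.* (+ a ℤ.- + b))
            ≡ (+ a ℤ.- + 1) ℤ.* (+ (n ∸ 1) ℤ.* + (a ^ (n + 1)) ℤ.* (+ a ℤ.- + b)
                 ℤ.- + (b ^ 3) ℤ.* (+ (a ^ (n ∸ 1)) ℤ.- + (b ^ (n ∸ 1))))))
theorem1p1 a b d zero    _   _   _   ()  _                 _
theorem1p1 a b d (suc m) 0<a 0<b 0<d _   (divides k b≡kd) gcd≡1 =
  (λ b≤a → _ , GenS₁-frobenius {k = k} 0<a 0<b 0<d b≡kd coprime b≤a m , gluedFrobenius-top₁ a b X m) ,
  (_ , GenS₂-frobenius {k = k} 0<a 0<b 0<d b≡kd coprime m , gluedFrobenius-top₂ a b X m)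
  where
  coprime : Coprime a b
  coprime = gcd≡1⇒coprime gcd≡1
  X : ℤ
  X = baseFrobenius a b d
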